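{- If $G$ is a $2$-connected outerplanar graph with $n$ vertices, then $G$ contains an induced path of size $\frac{\log n}{2}$.
   Context: An outerplanar graph is a graph that can be drawn in the plane without crossing edges and with all vertices on the outer face. The size of a path is its number of vertices. Logarithms are base 2. -}

module Defs where

open import Data.Nat using (ℕ; _<_; _≤_; _+_)
open import Data.Fin using (Fin; toℕ)
open import Data.Bool using (Bool; true)
open import Data.Product using (Σ; _×_; ∃; ∃-syntax)
open import Data.Sum using (_⊎_)
open import Relation.Binary.PropositionalEquality using (_≡_; _≢_)
open import Relation.Nullary using (¬_)
open import Function.Definitions using (Injective)
open import Function.Bundles using (_⇔_)

record Graph (n : ℕ) : Set where
  field
    E     : Fin n → Fin n → Bool
    sym   : ∀ x y → E x y ≡ E y x
    irref : ∀ x → ¬ (E x x ≡ true)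

open Graph public

Adj : ∀ {n} → Graph n → Fin n → Fin n → Set
Adj G x y = E G x y ≡ true

data Walk {n : ℕ} (G : Graph n) (P : Fin n → Set) : Fin n → Fin n → Set where
  here : ∀ {x} → P x → Walk G P x x
  step : ∀ {x y z} → P x → Adj G x y → Walk G P y z → Walk G P x z

Connected : ∀ {n} → Graph n → Set
Connected {n} G = ∀ (x y : Fin n) → Walk G (λ _ → Fin n) x y

TwoConnected : ∀ {n} → Graph n → Set
TwoConnected {n} G =
  (3 ≤ n) × Connected G ×
  (∀ (v x y : Fin n) → x ≢ v → y ≢ v → Walk G (λ w → w ≢ v) x y)

-- Outerplanar: there is a placement of the vertices at distinct points of a
-- circle (a cyclic order, given by an injective position map pos) such that
-- drawing every edge as a chord yields no crossing: no two edges {a,c},{b,d}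
-- have interleaved endpoints pos a < pos b < pos c < pos d.
Outerplanar : ∀ {n} → Graph n → Set
Outerplanar {n} G =
  Σ (Fin n → Fin n) λ pos →
    Injective _≡_ _≡_ pos ×
    (∀ (a b c d : Fin n) → Adj G a c → Adj G b d →
       ¬ (toℕ (pos a) < toℕ (pos b) × toℕ (pos b) < toℕ (pos c)
          × toℕ (pos c) < toℕ (pos d)))

InducedPath : ∀ {n} → Graph n → (k : ℕ) → (Fin k → Fin n) → Set
InducedPath G k p =
  Injective _≡_ _≡_ p ×
  (∀ i j → Adj G (p i) (p j) ⇔ (toℕ i + 1 ≡ toℕ j ⊎ toℕ j + 1 ≡ toℕ i))

{-# OPTIONS --safe #-}
-- Number the vertices 0, …, n - 1 along the circle of the drawing, so that edges are pairwise
-- non-crossing chords. Two-connectivity forces i and i + 1 to be adjacent: some edge jumps over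
-- the gap between them, and deleting one end of a chord leaves the vertices it encloses connected
-- to the rest; as chords do not cross, the edge by which they leave lets us move the jumping edge
-- until it starts at i, and then shrink it down to the edge i – (i + 1).
-- On an interval [a, b] we then build induced paths from a and from b inside (a, b) whose total
-- length k satisfies b - a ≤ 2^k. Let c be the farthest neighbour of a in (a, b) and recurse on
-- [a, c] and [c, b]; as b - a = (c - a) + (b - c), it suffices to lengthen the better half by one
-- vertex. For [c, b], put a in front of its path from c. For [a, c], climb greedily from b down
-- to c and continue with its path from c, which the chord a – c hides from everything above c.
-- For [0, n - 1] the longer of the two paths, with its end vertex, has k vertices and n ≤ 4^k.
module Submission where

open import Defs hiding (sym)
open import Data.Nat using (ℕ; zero; suc; _+_; _*_; _∸_; _^_; _≤_; _<_; s≤s; s≤s⁻¹; z<s; _≤?_; _<?_)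
open import Data.Nat.Properties
open import Data.Nat.DivMod using (_mod_; _%_; m%n<n; m<n⇒m%n≡m)
open import Data.Nat.Induction using (<-wellFounded)
open import Induction.WellFounded using (Acc; acc)
open import Data.Fin using (Fin; toℕ; zero; suc; punchOut)
open import Data.Fin.Properties
  using (toℕ-injective; toℕ<n; toℕ-fromℕ<; any?; punchOut-injective; injective⇒≤)
  renaming (_≟_ to _≟ᶠ_)
open import Data.Bool using (true) renaming (_≟_ to _≟ᵇ_)
open import Data.List using (List; []; _∷_; length; lookup)
open import Data.List.Relation.Unary.All as All using (All; []; _∷_)
open import Data.List.Membership.Propositional.Properties using (∈-lookup)
open import Data.Product using (Σ; ∃; ∃₂; ∃-syntax; _×_; _,_; proj₁; proj₂)
open import Data.Sum as Sum using (_⊎_; inj₁; inj₂)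
open import Data.Unit using (⊤; tt)
open import Data.Empty using (⊥; ⊥-elim)
open import Function using (_∘_)
open import Function.Bundles using (_⇔_; mk⇔)
open import Function.Definitions using (Injective)
open import Relation.Nullary using (¬_; Dec; yes; no; contradiction)
open import Relation.Nullary.Decidable using (_×-dec_)
open import Relation.Unary using (Decidable)
open import Relation.Binary using (Symmetric; tri<; tri≈; tri>)
open import Relation.Binary.PropositionalEquality
  using (_≡_; _≢_; refl; sym; trans; cong; subst; subst₂; module ≡-Reasoning)

injective⇒surjective : ∀ {n} {f : Fin n → Fin n} → Injective _≡_ _≡_ f → ∀ i → ∃ λ j → f j ≡ i
injective⇒surjective {suc n} {f} f-injective i with any? (λ j → f j ≟ᶠ i)
... | yes hit = hit
... | no miss = contradiction (injective⇒≤ skip-injective) 1+n≰n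
  where
  skip : Fin (suc n) → Fin n
  skip j = punchOut (λ i≡fj → miss (j , sym i≡fj))
  skip-injective : Injective _≡_ _≡_ skip
  skip-injective = f-injective ∘ punchOut-injective {i = i} _ _

module _ {P : ℕ → Set} (P? : Decidable P) where

  greatest-below : ∀ {x} b → x < b → P x →
    ∃[ y ] x ≤ y × y < b × P y × (∀ {z} → y < z → z < b → ¬ P z)
  greatest-below (suc b) x<1+b px with P? b
  ... | yes pb = b , s≤s⁻¹ x<1+b , n<1+n b , pb , λ b<z z<1+b _ → <⇒≱ b<z (s≤s⁻¹ z<1+b)
  ... | no ¬pb with m≤n⇒m<n∨m≡n (s≤s⁻¹ x<1+b)
  ...   | inj₂ refl = contradiction px ¬pb
  ...   | inj₁ x<b with greatest-below b x<b px
  ...     | y , x≤y , y<b , py , beyond = y , x≤y , m<n⇒m<1+n y<b , py , beyond′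
    where
    beyond′ : ∀ {z} → y < z → z < suc b → ¬ P z
    beyond′ y<z z<1+b with m≤n⇒m<n∨m≡n (s≤s⁻¹ z<1+b)
    ... | inj₁ z<b = beyond y<z z<b
    ... | inj₂ refl = ¬pb

split-interval-bound : ∀ {a b c k₁ k₂ k k′} → b ≤ c + 2 ^ k₁ → c ≤ a + 2 ^ k₂ →
  k₁ ≤ k → k₂ ≤ k → k < k′ → b ≤ a + 2 ^ k′
split-interval-bound {a} {b} {c} {k₁} {k₂} {k} {k′} b≤ c≤ k₁≤k k₂≤k k<k′ = begin
  b                     ≤⟨ b≤ ⟩
  c + 2 ^ k₁            ≤⟨ +-mono-≤ c≤ (^-monoʳ-≤ 2 k₁≤k) ⟩
  (a + 2 ^ k₂) + 2 ^ k  ≤⟨ +-monoˡ-≤ (2 ^ k) (+-monoʳ-≤ a (^-monoʳ-≤ 2 k₂≤k)) ⟩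
  (a + 2 ^ k) + 2 ^ k   ≡⟨ +-assoc a (2 ^ k) (2 ^ k) ⟩
  a + (2 ^ k + 2 ^ k)   ≡⟨ cong (λ x → a + (2 ^ k + x)) (sym (+-identityʳ (2 ^ k))) ⟩
  a + 2 ^ suc k         ≤⟨ +-monoʳ-≤ a (^-monoʳ-≤ 2 k<k′) ⟩
  a + 2 ^ k′            ∎
  where open ≤-Reasoning

four-power-bound : ∀ {n s t} → n ≤ 2 ^ (t + s) → s ≤ t → suc n ≤ 4 ^ suc t
four-power-bound {n} {s} {t} n≤ s≤t = begin
  suc n              ≤⟨ s≤s (≤-trans n≤ (^-monoʳ-≤ 2 (+-monoʳ-≤ t (≤-trans s≤t (m≤m+n t 0))))) ⟩
  suc (2 ^ (2 * t))  ≡⟨ cong suc (sym (^-*-assoc 2 2 t)) ⟩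
  suc (4 ^ t)        ≤⟨ +-monoˡ-≤ (4 ^ t) (m^n>0 4 t) ⟩
  4 ^ t + 4 ^ t      ≤⟨ +-monoʳ-≤ (4 ^ t) (m≤m+n (4 ^ t) (2 * 4 ^ t)) ⟩
  4 ^ suc t          ∎
  where open ≤-Reasoning

walk-head : ∀ {n} {G : Graph n} {Q : Fin n → Set} {x y} → Walk G Q x y → Q x
walk-head (here qx)     = qx
walk-head (step qx _ _) = qx

walk-exit : ∀ {n} {G : Graph n} {Q S : Fin n → Set} → Decidable S → ∀ {s t} →
  Walk G Q s t → S s → ¬ S t → ∃₂ λ u w → S u × ¬ S w × Q w × Adj G u w
walk-exit S? (here _) s∈S t∉S = contradiction s∈S t∉S
walk-exit S? (step {y = y} _ sy walk) s∈S t∉S with S? y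
... | yes y∈S = walk-exit S? walk y∈S t∉S
... | no y∉S  = _ , y , s∈S , y∉S , walk-head walk , sy

IsInducedPath : {A : Set} → (A → A → Set) → List A → Set
IsInducedPath R []          = ⊤
IsInducedPath R (x ∷ [])    = ⊤
IsInducedPath R (x ∷ y ∷ l) =
  R x y × All (¬_ ∘ R x) l × All (x ≢_) (y ∷ l) × IsInducedPath R (y ∷ l)

Consecutive : ℕ → ℕ → Set
Consecutive i j = i + 1 ≡ j ⊎ j + 1 ≡ i

module _ {A : Set} {R : A → A → Set} where

  lookup-injective : ∀ l → IsInducedPath R l → Injective _≡_ _≡_ (lookup l)
  lookup-injective (x ∷ _)     _ {zero}  {zero}  _ = refl
  lookup-injective (x ∷ y ∷ l) (_ , _ , x∉ , _) {zero}  {suc j} e =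
    contradiction e (All.lookup x∉ (∈-lookup j))
  lookup-injective (x ∷ y ∷ l) (_ , _ , x∉ , _) {suc i} {zero}  e =
    contradiction (sym e) (All.lookup x∉ (∈-lookup i))
  lookup-injective (x ∷ y ∷ l) (_ , _ , _ , p) {suc i} {suc j} e =
    cong suc (lookup-injective (y ∷ l) p e)

  module _ (R-sym : Symmetric R) (R-irrefl : ∀ x → ¬ R x x) where

    adjacent⇒consecutive : ∀ l → IsInducedPath R l → ∀ i j →
      R (lookup l i) (lookup l j) → Consecutive (toℕ i) (toℕ j)
    adjacent⇒consecutive (x ∷ _)     _ zero zero r = ⊥-elim (R-irrefl x r)
    adjacent⇒consecutive (x ∷ y ∷ l) _ zero (suc zero) _ = inj₁ refl
    adjacent⇒consecutive (x ∷ y ∷ l) (_ , far , _) zero (suc (suc j)) r =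
      ⊥-elim (All.lookup far (∈-lookup j) r)
    adjacent⇒consecutive (x ∷ y ∷ l) _ (suc zero) zero _ = inj₂ refl
    adjacent⇒consecutive (x ∷ y ∷ l) (_ , far , _) (suc (suc i)) zero r =
      ⊥-elim (All.lookup far (∈-lookup i) (R-sym r))
    adjacent⇒consecutive (x ∷ y ∷ l) (_ , _ , _ , p) (suc i) (suc j) r =
      Sum.map (cong suc) (cong suc) (adjacent⇒consecutive (y ∷ l) p i j r)

    consecutive⇒adjacent : ∀ l → IsInducedPath R l → ∀ i j →
      Consecutive (toℕ i) (toℕ j) → R (lookup l i) (lookup l j)
    consecutive⇒adjacent (x ∷ _) _ zero zero (inj₁ ())
    consecutive⇒adjacent (x ∷ _) _ zero zero (inj₂ ())
    consecutive⇒adjacent (x ∷ y ∷ l) (xy , _) zero (suc zero) _ = xy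
    consecutive⇒adjacent (x ∷ y ∷ l) _ zero (suc (suc j)) (inj₁ ())
    consecutive⇒adjacent (x ∷ y ∷ l) _ zero (suc (suc j)) (inj₂ ())
    consecutive⇒adjacent (x ∷ y ∷ l) (xy , _) (suc zero) zero _ = R-sym xy
    consecutive⇒adjacent (x ∷ y ∷ l) _ (suc (suc i)) zero (inj₁ ())
    consecutive⇒adjacent (x ∷ y ∷ l) _ (suc (suc i)) zero (inj₂ ())
    consecutive⇒adjacent (x ∷ y ∷ l) (_ , _ , _ , p) (suc i) (suc j) c =
      consecutive⇒adjacent (y ∷ l) p i j (Sum.map suc-injective suc-injective c)

    adjacent⇔consecutive : ∀ l → IsInducedPath R l → ∀ i j →
      R (lookup l i) (lookup l j) ⇔ Consecutive (toℕ i) (toℕ j)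
    adjacent⇔consecutive l p i j =
      mk⇔ (adjacent⇒consecutive l p i j) (consecutive⇒adjacent l p i j)

module ChordsOverPath
  (N : ℕ) {R : ℕ → ℕ → Set} (R? : ∀ x y → Dec (R x y)) (R-sym : Symmetric R)
  (path : ∀ {p} → suc p < N → R p (suc p))
  (noncrossing : ∀ {a b c d} → a < b → b < c → c < d → d < N → R a c → R b d → ⊥)
  where

  Inside : ℕ → ℕ → ℕ → Set
  Inside a b z = a < z × z < b

  inside-widen : ∀ {a a′ b b′ l} → a′ ≤ a → b ≤ b′ → All (Inside a b) l → All (Inside a′ b′) l
  inside-widen a′≤a b≤b′ = All.map λ (a<z , z<b) → ≤-<-trans a′≤a a<z , <-≤-trans z<b b≤b′

  cons-above : ∀ {a c y L} → c < y → R y c → All (¬_ ∘ R y) L → All (Inside a c) L →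
    IsInducedPath R (c ∷ L) → IsInducedPath R (y ∷ c ∷ L)
  cons-above c<y yc far inside cL =
    yc , far , >⇒≢ c<y ∷ All.map (λ (_ , z<c) → >⇒≢ (<-trans z<c c<y)) inside , cL

  cons-below : ∀ {b c y L} → y < c → R y c → All (¬_ ∘ R y) L → All (Inside c b) L →
    IsInducedPath R (c ∷ L) → IsInducedPath R (y ∷ c ∷ L)
  cons-below y<c yc far inside cL =
    yc , far , <⇒≢ y<c ∷ All.map (λ (c<z , _) → <⇒≢ (<-trans y<c c<z)) inside , cL

  chord-separates : ∀ {a c y z} → a < z → z < c → c < y → y < N → R a c → ¬ R y z
  chord-separates a<z z<c c<y y<N ac yz = noncrossing a<z z<c c<y y<N ac (R-sym yz)

  -- Each step moves from c to its farthest neighbour g ≤ y, so nothing in (g, y] sees c.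
  climb : ∀ {a c y L} → Acc _<_ (y ∸ c) → a < c → c < y → y < N →
    IsInducedPath R (c ∷ L) → All (Inside a c) L → (∀ {z} → c < z → z ≤ y → All (¬_ ∘ R z) L) →
    ∃[ L′ ] IsInducedPath R (y ∷ L′) × All (Inside a y) L′ × length L < length L′
  climb {c = c} {y} {L} (acc rs) a<c c<y y<N cL inside unseen
    with greatest-below (R? c) (suc y) (s≤s c<y) (path (≤-<-trans c<y y<N))
  ... | g , c<g , g<1+y , cg , beyond with m≤n⇒m<n∨m≡n (s≤s⁻¹ g<1+y)
  ...   | inj₂ refl =
    c ∷ L , cons-above c<y (R-sym cg) (unseen c<y ≤-refl) inside cL ,
    (a<c , c<y) ∷ inside-widen ≤-refl (<⇒≤ c<y) inside , ≤-refl
  ...   | inj₁ g<y =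
    let L′ , yL′ , L′-inside , longer =
          climb (rs (∸-monoʳ-< c<g (<⇒≤ g<y))) (<-trans a<c c<g) g<y y<N
            (cons-above c<g (R-sym cg) (unseen c<g (<⇒≤ g<y)) inside cL)
            ((a<c , c<g) ∷ inside-widen ≤-refl (<⇒≤ c<g) inside)
            (λ g<z z≤y → (beyond g<z (s≤s z≤y) ∘ R-sym) ∷ unseen (<-trans c<g g<z) z≤y)
    in L′ , yL′ , L′-inside , ≤-trans (n≤1+n _) longer

  record EndPaths (a b : ℕ) : Set where
    field
      left right    : List ℕ
      left-induced  : IsInducedPath R (a ∷ left)
      right-induced : IsInducedPath R (b ∷ right)
      left-inside   : All (Inside a b) left
      right-inside  : All (Inside a b) right

    size : ℕ
    size = length left + length right

  open EndPaths

  extend-left : ∀ {a b c} → a < c → c < b → R a c → (∀ {z} → c < z → z < b → ¬ R a z) →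
    (E : EndPaths c b) → Σ (EndPaths a b) λ E′ → size E < size E′
  extend-left a<c c<b ac beyond E = record
    { left          = _ ∷ left E
    ; right         = right E
    ; left-induced  = cons-below a<c ac (All.map (λ (c<z , z<b) → beyond c<z z<b) (left-inside E))
                        (left-inside E) (left-induced E)
    ; right-induced = right-induced E
    ; left-inside   = (a<c , c<b) ∷ inside-widen (<⇒≤ a<c) ≤-refl (left-inside E)
    ; right-inside  = inside-widen (<⇒≤ a<c) ≤-refl (right-inside E)
    } , ≤-refl

  extend-right : ∀ {a b c} → a < c → c < b → b < N → R a c →
    (E : EndPaths a c) → Σ (EndPaths a b) λ E′ → size E < size E′
  extend-right {b = b} {c = c} a<c c<b b<N ac E =
    let L , bL , L-inside , longer = climb (<-wellFounded (b ∸ c)) a<c c<b b<N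
          (right-induced E) (right-inside E) unseen
    in record
      { left          = left E
      ; right         = L
      ; left-induced  = left-induced E
      ; right-induced = bL
      ; left-inside   = inside-widen ≤-refl (<⇒≤ c<b) (left-inside E)
      ; right-inside  = L-inside
      } , +-monoʳ-< (length (left E)) longer
    where
    unseen : ∀ {z} → c < z → z ≤ b → All (¬_ ∘ R z) (right E)
    unseen c<z z≤b = All.map (λ (a<x , x<c) → chord-separates a<x x<c c<z (≤-<-trans z≤b b<N) ac)
                             (right-inside E)

  end-paths : ∀ {a b} → Acc _<_ (b ∸ a) → a < b → b < N →
    Σ (EndPaths a b) λ E → b ≤ a + 2 ^ size E
  end-paths {a} {b} (acc rs) a<b b<N with m≤n⇒m<n∨m≡n a<b
  ... | inj₂ refl = record
    { left = [] ; right = [] ; left-induced = tt ; right-induced = tt ; left-inside = [] ; right-inside = [] }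
    , ≤-reflexive (+-comm 1 a)
  ... | inj₁ 1+a<b with greatest-below (R? a) b 1+a<b (path (<-trans 1+a<b b<N))
  ...   | c , a<c , c<b , ac , beyond
    with end-paths (rs (∸-monoʳ-< a<c (<⇒≤ c<b))) c<b b<N
       | end-paths (rs (∸-monoˡ-< c<b (<⇒≤ a<c))) a<c (<-trans c<b b<N)
  ...     | E₁ , b≤ | E₂ , c≤ with ≤-total (size E₂) (size E₁)
  ...       | inj₁ k₂≤k₁ = let E , grows = extend-left a<c c<b ac beyond E₁
                           in E , split-interval-bound b≤ c≤ ≤-refl k₂≤k₁ grows
  ...       | inj₂ k₁≤k₂ = let E , grows = extend-right a<c c<b b<N ac E₂
                           in E , split-interval-bound b≤ c≤ k₁≤k₂ ≤-refl grows

module Drawing {m : ℕ} (G : Graph (suc m))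
  (pos : Fin (suc m) → Fin (suc m)) (pos-injective : Injective _≡_ _≡_ pos)
  (noncrossing : ∀ (a b c d : Fin (suc m)) → Adj G a c → Adj G b d →
     ¬ (toℕ (pos a) < toℕ (pos b) × toℕ (pos b) < toℕ (pos c) × toℕ (pos c) < toℕ (pos d)))
  (connected : Connected G)
  (avoiding : ∀ (v x y : Fin (suc m)) → x ≢ v → y ≢ v → Walk G (λ w → w ≢ v) x y)
  where

  N : ℕ
  N = suc m

  position : Fin N → ℕ
  position v = toℕ (pos v)

  opaque
    -- Positions are read modulo N; only positions below N are ever used.
    vertexAt : ℕ → Fin N
    vertexAt x = proj₁ (injective⇒surjective pos-injective (x mod N))

    position-vertexAt : ∀ {x} → x < N → position (vertexAt x) ≡ x
    position-vertexAt {x} x<N = begin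
      toℕ (pos (vertexAt x)) ≡⟨ cong toℕ (proj₂ (injective⇒surjective pos-injective (x mod N))) ⟩
      toℕ (x mod N)          ≡⟨ toℕ-fromℕ< (m%n<n x N) ⟩
      x % N                  ≡⟨ m<n⇒m%n≡m x<N ⟩
      x                      ∎
      where open ≡-Reasoning

  vertexAt-position : ∀ v → vertexAt (position v) ≡ v
  vertexAt-position v = pos-injective (toℕ-injective (position-vertexAt (toℕ<n (pos v))))

  vertexAt-injective : ∀ {x y} → x < N → y < N → vertexAt x ≡ vertexAt y → x ≡ y
  vertexAt-injective x<N y<N e =
    trans (sym (position-vertexAt x<N)) (trans (cong position e) (position-vertexAt y<N))

  Edge : ℕ → ℕ → Set
  Edge x y = Adj G (vertexAt x) (vertexAt y)

  Edge? : ∀ x y → Dec (Edge x y)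
  Edge? x y = E G (vertexAt x) (vertexAt y) ≟ᵇ true

  Edge-sym : Symmetric Edge
  Edge-sym {x} {y} xy = trans (Graph.sym G (vertexAt y) (vertexAt x)) xy

  Edge-irrefl : ∀ x → ¬ Edge x x
  Edge-irrefl x = irref G (vertexAt x)

  edge-noncrossing : ∀ {a b c d} → a < b → b < c → c < d → d < N → Edge a c → Edge b d → ⊥
  edge-noncrossing a<b b<c c<d d<N ac bd =
    noncrossing _ _ _ _ ac bd (placed a<b b<N , placed b<c c<N , placed c<d d<N)
    where
    c<N = <-trans c<d d<N
    b<N = <-trans b<c c<N
    placed : ∀ {x y} → x < y → y < N → position (vertexAt x) < position (vertexAt y)
    placed x<y y<N =
      subst₂ _<_ (sym (position-vertexAt (<-trans x<y y<N))) (sym (position-vertexAt y<N)) x<y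

  position-exit : ∀ {S : ℕ → Set} {Q : Fin N → Set} {x y} → Decidable S →
    Walk G Q (vertexAt x) (vertexAt y) → x < N → y < N → S x → ¬ S y →
    ∃₂ λ u w → S u × ¬ S w × w < N × Q (vertexAt w) × Edge u w
  position-exit {S} {Q} S? walk x<N y<N x∈S y∉S =
    let u , w , u∈S , w∉S , qw , uw = walk-exit (S? ∘ position) walk
          (subst S (sym (position-vertexAt x<N)) x∈S) (y∉S ∘ subst S (position-vertexAt y<N))
    in position u , position w , u∈S , w∉S , toℕ<n (pos w) , subst Q (sym (vertexAt-position w)) qw ,
       subst₂ (Adj G) (sym (vertexAt-position u)) (sym (vertexAt-position w)) uw

  exit-avoiding : ∀ {S : ℕ → Set} {a x y} → Decidable S → a < N → x < N → y < N → x ≢ a → y ≢ a →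
    S x → ¬ S y → ∃₂ λ u w → S u × ¬ S w × w < N × w ≢ a × Edge u w
  exit-avoiding S? a<N x<N y<N x≢a y≢a x∈S y∉S =
    let u , w , u∈S , w∉S , w<N , w≢a , uw = position-exit S?
          (avoiding _ _ _ (x≢a ∘ vertexAt-injective x<N a<N) (y≢a ∘ vertexAt-injective y<N a<N))
          x<N y<N x∈S y∉S
    in u , w , u∈S , w∉S , w<N , w≢a ∘ cong vertexAt , uw

  -- Removing a, the vertices of (a, c] still reach b; a chord a–b blocks every exit below a.
  exit-above : ∀ {a b c} → a < c → c < b → b < N → Edge a b →
    ∃₂ λ u w → a < u × u ≤ c × c < w × w < N × Edge u w
  exit-above {a} {c = c} a<c c<b b<N ab
    with exit-avoiding (λ z → (a <? z) ×-dec (z ≤? c)) (<-trans a<c c<N) c<N b<N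
           (>⇒≢ a<c) (>⇒≢ (<-trans a<c c<b)) (a<c , ≤-refl) (λ (_ , b≤c) → <⇒≱ c<b b≤c)
    where c<N = <-trans c<b b<N
  ... | u , w , (a<u , u≤c) , w∉ , w<N , w≢a , uw with <-cmp w a
  ...   | tri< w<a _ _ = ⊥-elim (edge-noncrossing w<a a<u (≤-<-trans u≤c c<b) b<N (Edge-sym uw) ab)
  ...   | tri≈ _ w≡a _ = contradiction w≡a w≢a
  ...   | tri> _ _ a<w = u , w , a<u , u≤c , ≰⇒> (w∉ ∘ (a<w ,_)) , w<N , uw

  -- Removing b, the vertices of (a, b) still reach a; the chord a–b leaves a as the only way out.
  inner-neighbour : ∀ {a b s} → a < s → s < b → b < N → Edge a b → ∃[ u ] a < u × u < b × Edge a u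
  inner-neighbour {a} {b} a<s s<b b<N ab
    with exit-avoiding (λ z → (a <? z) ×-dec (z <? b)) b<N
           (<-trans s<b b<N) (<-trans (<-trans a<s s<b) b<N) (<⇒≢ s<b) (<⇒≢ (<-trans a<s s<b))
           (a<s , s<b) (λ (a<a , _) → <-irrefl refl a<a)
  ... | u , w , (a<u , u<b) , w∉ , w<N , w≢b , uw with <-cmp w a
  ...   | tri< w<a _ _ = ⊥-elim (edge-noncrossing w<a a<u u<b b<N (Edge-sym uw) ab)
  ...   | tri≈ _ refl _ = u , a<u , u<b , Edge-sym uw
  ...   | tri> _ _ a<w =
    ⊥-elim (edge-noncrossing a<u u<b (≤∧≢⇒< (≮⇒≥ (w∉ ∘ (a<w ,_))) (w≢b ∘ sym)) w<N ab uw)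

  gap-edge : ∀ {p} → suc p < N → ∃₂ λ x y → x ≤ p × p < y × y < N × Edge x y
  gap-edge {p} 1+p<N
    with position-exit (_≤? p) (connected (vertexAt p) (vertexAt (suc p)))
           (<-trans (n<1+n p) 1+p<N) 1+p<N ≤-refl 1+n≰n
  ... | x , y , x≤p , y≰p , y<N , _ , xy = x , y , x≤p , ≰⇒> y≰p , y<N , xy

  neighbour-above : ∀ {p x y} → Acc _<_ (p ∸ x) → x ≤ p → p < y → y < N → Edge x y →
    ∃[ y′ ] p < y′ × y′ < N × Edge p y′
  neighbour-above (acc rs) x≤p p<y y<N xy with m≤n⇒m<n∨m≡n x≤p
  ... | inj₂ refl = _ , p<y , y<N , xy
  ... | inj₁ x<p with exit-above x<p p<y y<N xy
  ...   | u , w , x<u , u≤p , p<w , w<N , uw =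
    neighbour-above (rs (∸-monoʳ-< x<u u≤p)) u≤p p<w w<N uw

  adjacent-successor : ∀ {p y} → Acc _<_ y → p < y → y < N → Edge p y → Edge p (suc p)
  adjacent-successor (acc rs) p<y y<N py with m≤n⇒m<n∨m≡n p<y
  ... | inj₂ refl = py
  ... | inj₁ 1+p<y with inner-neighbour (n<1+n _) 1+p<y y<N py
  ...   | u , p<u , u<y , pu = adjacent-successor (rs u<y) p<u (<-trans u<y y<N) pu

  edge-suc : ∀ {p} → suc p < N → Edge p (suc p)
  edge-suc 1+p<N =
    let x , y , x≤p , p<y , y<N , xy = gap-edge 1+p<N
        y′ , p<y′ , y′<N , py′ = neighbour-above (<-wellFounded _) x≤p p<y y<N xy
    in adjacent-successor (<-wellFounded y′) p<y′ y′<N py′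

  open ChordsOverPath N Edge? Edge-sym edge-suc edge-noncrossing
  open EndPaths

  induced-path : ∀ {L} → IsInducedPath Edge L → All (_< N) L →
    InducedPath G (length L) (vertexAt ∘ lookup L)
  induced-path {L} p bounded =
    (λ e → lookup-injective L p (vertexAt-injective (bound _) (bound _) e)) ,
    adjacent⇔consecutive Edge-sym Edge-irrefl L p
    where
    bound : ∀ i → lookup L i < N
    bound i = All.lookup bounded (∈-lookup i)

  inside-N : ∀ {l} → All (Inside 0 m) l → All (_< N) l
  inside-N = All.map λ (_ , z<m) → m<n⇒m<1+n z<m

  long-induced-path : 0 < m → Σ ℕ λ k → Σ (Fin k → Fin N) λ p → InducedPath G k p × N ≤ 4 ^ k
  long-induced-path 0<m with end-paths (<-wellFounded (m ∸ 0)) 0<m (n<1+n m)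
  ... | E , m≤ with ≤-total (length (right E)) (length (left E))
  ...   | inj₁ r≤l = _ , _ , induced-path (left-induced E) (z<s ∷ inside-N (left-inside E)) ,
                     four-power-bound m≤ r≤l
  ...   | inj₂ l≤r = _ , _ , induced-path (right-induced E) (n<1+n m ∷ inside-N (right-inside E)) ,
                     four-power-bound (subst (λ k → m ≤ 2 ^ k) (+-comm (length (left E)) _) m≤) l≤r

theorem8 : ∀ (n : ℕ) (G : Graph n) → TwoConnected G → Outerplanar G →
    Σ ℕ λ k → Σ (Fin k → Fin n) λ p → InducedPath G k p × n ≤ 4 ^ k
theorem8 zero G (() , _) _
theorem8 (suc m) G (3≤n , connected , avoiding) (pos , pos-injective , noncrossing) =
  long-induced-path (<-≤-trans z<s (s≤s⁻¹ 3≤n))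
  where open Drawing G pos pos-injective noncrossing connected avoiding
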